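{- Let $y$ be a nonnegative integer and $x\in\mathbb{R}$. Let $Star_y$ be the graph with vertices $v_0,v_1,\dots,v_y$, edges $v_0v_i$ for $1\le i\le y$, and a loop at every vertex. Define vertex weights $\alpha(v_0)=1$, $\alpha(v_i)=x$ for $i\ge1$, and edge weights $\beta\equiv 1$. Then for every finite simple graph $G=(V,E)$, \[ Q(G;x,y)=\sum_{h:V\to V(Star_y)\ \text{homomorphism}}\ \prod_{v\in V}\alpha(h(v))\prod_{\{u,v\}\in E}\beta(h(u),h(v)). \]
   Context: For a finite simple graph $G=(V,E)$, $Q(G;x,y)=\sum_{X\subseteq V}x^{|X|}y^{k(G[X])}$, where $G[X]$ is the induced subgraph, $k$ is the number of connected components (the null graph has $k=0$), and $0^0=1$. A homomorphism $h:V\to V(Star_y)$ is a map sending adjacent vertices to adjacent vertices of $Star_y$ (loops allowed, so adjacent vertices may map to the same vertex). -}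

module Defs where

open import Level using (Level)
open import Data.Nat using (ℕ; zero; suc; _<ᵇ_)
import Data.Nat as ℕ
open import Data.Bool using (Bool; true; false; _∧_; _∨_; not; if_then_else_)
open import Data.Fin using (Fin; toℕ; _≟_)
import Data.Fin as F
open import Data.List using (List; []; _∷_; [_]; map; concatMap; allFin; foldr)
open import Data.Bool.ListAction using (any)
open import Relation.Nullary.Decidable using (⌊_⌋)
open import Algebra.Bundles using (CommutativeSemiring)
open import Relation.Binary.PropositionalEquality using (_≡_)

record SimpleGraph (n : ℕ) : Set where
  field
    adj     : Fin n → Fin n → Bool
    sym     : ∀ u v → adj u v ≡ adj v u
    irrefl  : ∀ v → adj v v ≡ false
open SimpleGraph public

allFuns : {A : Set} → List A → (n : ℕ) → List (Fin n → A)
allFuns xs zero    = [ (λ ()) ]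
allFuns xs (suc n) = concatMap (λ a → map (λ f → λ { F.zero → a ; (F.suc i) → f i }) (allFuns xs n)) xs

allSubsets : (n : ℕ) → List (Fin n → Bool)
allSubsets n = allFuns (true ∷ false ∷ []) n

countB : {A : Set} → (A → Bool) → List A → ℕ
countB p = foldr (λ a k → if p a then suc k else k) 0

_==ᶠ_ : {n : ℕ} → Fin n → Fin n → Bool
u ==ᶠ v = ⌊ u ≟ v ⌋

card : {n : ℕ} → (Fin n → Bool) → ℕ
card {n} X = countB X (allFin n)

-- reachIter m u v : there is a walk u = w0, ..., wj = v with j ≤ m,
-- all wi ∈ X, consecutive vertices adjacent in G (i.e. a walk in G[X]).
reachIter : {n : ℕ} → SimpleGraph n → (Fin n → Bool) → ℕ → Fin n → Fin n → Bool
reachIter G X zero    u v = X u ∧ X v ∧ (u ==ᶠ v)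
reachIter {n} G X (suc m) u v =
  reachIter G X m u v ∨ any (λ w → reachIter G X m u w ∧ adj G w v ∧ X v) (allFin n)

-- u, v in the same connected component of G[X] (walks of length ≤ n suffice)
sameComp : {n : ℕ} → SimpleGraph n → (Fin n → Bool) → Fin n → Fin n → Bool
sameComp {n} G X = reachIter G X n

-- k(G[X]): number of connected components of G[X], counted as the number of
-- vertices v ∈ X that are the least vertex of their component (0 for X = ∅)
components : {n : ℕ} → SimpleGraph n → (Fin n → Bool) → ℕ
components {n} G X =
  countB (λ v → X v ∧ not (any (λ u → (toℕ u <ᵇ toℕ v) ∧ sameComp G X u v) (allFin n))) (allFin n)

-- Vertices of Star_y: Fin (suc y), v_0 = zero. Adjacency including loops.
starAdj : {y : ℕ} → Fin (suc y) → Fin (suc y) → Bool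
starAdj a b = (a ==ᶠ b) ∨ (a ==ᶠ F.zero) ∨ (b ==ᶠ F.zero)

isHom : {n y : ℕ} → SimpleGraph n → (Fin n → Fin (suc y)) → Bool
isHom {n} G h =
  not (any (λ u → any (λ v → adj G u v ∧ not (starAdj (h u) (h v))) (allFin n)) (allFin n))

module _ {c ℓ : Level} (R : CommutativeSemiring c ℓ) where
  open CommutativeSemiring R

  sumR : {A : Set} → (A → Carrier) → List A → Carrier
  sumR f = foldr (λ a s → f a + s) 0#

  prodR : {A : Set} → (A → Carrier) → List A → Carrier
  prodR f = foldr (λ a s → f a * s) 1#

  powR : Carrier → ℕ → Carrier
  powR x zero    = 1#
  powR x (suc k) = x * powR x k

  fromℕ : ℕ → Carrier
  fromℕ zero    = 0#
  fromℕ (suc k) = 1# + fromℕ k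

  -- Q(G; x, y) = Σ_{X ⊆ V} x^{|X|} y^{k(G[X])}   (y^k computed in ℕ, 0^0 = 1)
  Q : {n : ℕ} → SimpleGraph n → Carrier → ℕ → Carrier
  Q {n} G x y = sumR (λ X → powR x (card X) * fromℕ (y ℕ.^ components G X)) (allSubsets n)

  α : {y : ℕ} → Carrier → Fin (suc y) → Carrier
  α x F.zero    = 1#
  α x (F.suc _) = x

  β : {y : ℕ} → Fin (suc y) → Fin (suc y) → Carrier
  β _ _ = 1#

  -- Σ_{h : V → V(Star_y) hom} Π_v α(h v) Π_{{u,v} ∈ E} β(h u, h v)
  -- edges {u,v} enumerated once as ordered pairs with u < v
  homSum : {n : ℕ} → SimpleGraph n → Carrier → ℕ → Carrier
  homSum {n} G x y =
    sumR (λ h → if isHom G h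
                  then prodR (λ v → α x (h v)) (allFin n)
                       * prodR (λ u → prodR (λ v → if adj G u v ∧ (toℕ u <ᵇ toℕ v)
                                                     then β (h u) (h v) else 1#)
                                            (allFin n)) (allFin n)
                  else 0#)
         (allFuns (allFin (suc y)) n)

module Submission where

-- Idea.  h : V → Star_y is a homomorphism iff the ends of every edge have
-- equal images or one of them is mapped to v₀.  So the homomorphisms whose
-- support {v | h v ≠ v₀} is a given X are the maps vanishing off X that are
-- nonzero and constant on every component of G[X]: there are y ^ k(G[X]) of
-- them, and each has weight x ^ |X|.  Hence Q(G; x, y) = Σ_X x^|X| y^k(G[X])
-- is the sum over X and over homomorphisms with support X of their weights,
-- which after exchanging the two sums is the homomorphism sum.

open import Defs hiding (sym)
open import Level using (Level)
open import Data.Nat using (ℕ; zero; suc; _^_; _≤_; _<_; z≤n; s≤s; _<ᵇ_)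
import Data.Nat as ℕ
import Data.Nat.Properties as ℕₚ
open import Data.Nat.ListAction using (sum)
open import Data.Bool using (Bool; true; false; _∧_; _∨_; not; if_then_else_)
import Data.Bool.Properties as Boolₚ
open import Data.Fin using (Fin; toℕ; _≟_)
import Data.Fin as F
import Data.Fin.Properties as Finₚ
open import Data.List using (List; []; _∷_; map; concatMap; allFin; tabulate; _++_; findᵇ)
open import Data.List.Properties using (map-cong; map-tabulate)
open import Data.Bool.ListAction using (any; all)
open import Data.Maybe using (Maybe; just; nothing)
open import Data.Product using (Σ; _×_; _,_; proj₁; proj₂)
open import Data.Sum using (_⊎_; inj₁; inj₂)
open import Data.Empty using (⊥; ⊥-elim)
open import Relation.Nullary using (¬_; Dec; yes; no)
open import Relation.Nullary.Decidable using (⌊_⌋)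
open import Relation.Binary.PropositionalEquality
  using (_≡_; _≢_; refl; sym; trans; cong; cong₂; subst; module ≡-Reasoning)
open import Function using (_∘_; id)
open import Function.Bundles using (Equivalence)
open import Algebra.Bundles using (CommutativeSemiring)

∧-elimˡ : ∀ {a b} → a ∧ b ≡ true → a ≡ true
∧-elimˡ {true} _ = refl

∧-elimʳ : ∀ {a b} → a ∧ b ≡ true → b ≡ true
∧-elimʳ {true} e = e

∧-intro : ∀ {a b} → a ≡ true → b ≡ true → a ∧ b ≡ true
∧-intro refl refl = refl

∨-elim : ∀ {a b} → a ∨ b ≡ true → a ≡ true ⊎ b ≡ true
∨-elim {true}  _ = inj₁ refl
∨-elim {false} e = inj₂ e

∨-introˡ : ∀ {a b} → a ≡ true → a ∨ b ≡ true
∨-introˡ refl = refl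

∨-introʳ : ∀ {a b} → b ≡ true → a ∨ b ≡ true
∨-introʳ {true}  _ = refl
∨-introʳ {false} e = e

not-true : ∀ {a} → not a ≡ true → a ≡ false
not-true {false} _ = refl

not-false : ∀ {a} → not a ≡ false → a ≡ true
not-false {true} _ = refl

not-intro : ∀ {a} → a ≡ false → not a ≡ true
not-intro refl = refl

true≢false : ∀ {a} → a ≡ true → a ≡ false → ⊥
true≢false refl ()

bool-ext : ∀ {a b} → (a ≡ true → b ≡ true) → (b ≡ true → a ≡ true) → a ≡ b
bool-ext {true}  {true}  _ _ = refl
bool-ext {true}  {false} f _ = sym (f refl)
bool-ext {false} {true}  _ g = g refl
bool-ext {false} {false} _ _ = refl

⌊⌋-sound : ∀ {P : Set} (d : Dec P) → ⌊ d ⌋ ≡ true → P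
⌊⌋-sound (yes p) _ = p

⌊⌋-complete : ∀ {P : Set} (d : Dec P) → P → ⌊ d ⌋ ≡ true
⌊⌋-complete (yes _) _ = refl
⌊⌋-complete (no ¬p) p = ⊥-elim (¬p p)

⌊⌋-refute : ∀ {P : Set} (d : Dec P) → ¬ P → ⌊ d ⌋ ≡ false
⌊⌋-refute (yes p) ¬p = ⊥-elim (¬p p)
⌊⌋-refute (no _)  _  = refl

==-sound : ∀ {n} {u v : Fin n} → (u ==ᶠ v) ≡ true → u ≡ v
==-sound {u = u} {v} = ⌊⌋-sound (u ≟ v)

==-refl : ∀ {n} (u : Fin n) → (u ==ᶠ u) ≡ true
==-refl u = ⌊⌋-complete (u ≟ u) refl

==-refute : ∀ {n} {u v : Fin n} → u ≢ v → (u ==ᶠ v) ≡ false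
==-refute {u = u} {v} = ⌊⌋-refute (u ≟ v)

==-suc : ∀ {k} (i b : Fin k) → (F.suc i ==ᶠ F.suc b) ≡ (i ==ᶠ b)
==-suc i b with i ≟ b
... | yes _ = refl
... | no  _ = refl

module _ {A : Set} (p : A → Bool) where

  any-intro : ∀ {n} (f : Fin n → A) (i : Fin n) → p (f i) ≡ true → any p (tabulate f) ≡ true
  any-intro f F.zero    e rewrite e = refl
  any-intro f (F.suc i) e with p (f F.zero)
  ... | true  = refl
  ... | false = any-intro (f ∘ F.suc) i e

  any-elim : ∀ {n} (f : Fin n → A) → any p (tabulate f) ≡ true → Σ (Fin n) λ i → p (f i) ≡ true
  any-elim {suc n} f e with p (f F.zero) in eq
  ... | true  = F.zero , eq
  ... | false = let i , q = any-elim (f ∘ F.suc) e in F.suc i , q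

  none-intro : ∀ {n} (f : Fin n → A) → (∀ i → p (f i) ≡ false) → any p (tabulate f) ≡ false
  none-intro {zero}  f h = refl
  none-intro {suc n} f h rewrite h F.zero = none-intro (f ∘ F.suc) (h ∘ F.suc)

  none-elim : ∀ {n} (f : Fin n → A) → any p (tabulate f) ≡ false → ∀ i → p (f i) ≡ false
  none-elim f e i with p (f i) in eq
  ... | false = refl
  ... | true  = ⊥-elim (true≢false (any-intro f i eq) e)

  all-intro : ∀ {n} (f : Fin n → A) → (∀ i → p (f i) ≡ true) → all p (tabulate f) ≡ true
  all-intro {zero}  f h = refl
  all-intro {suc n} f h = ∧-intro (h F.zero) (all-intro (f ∘ F.suc) (h ∘ F.suc))

  all-elim : ∀ {n} (f : Fin n → A) → all p (tabulate f) ≡ true → ∀ i → p (f i) ≡ true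
  all-elim f e F.zero    = ∧-elimˡ e
  all-elim f e (F.suc i) = all-elim (f ∘ F.suc) (∧-elimʳ {p (f F.zero)} e) i

findᵇ-just : ∀ {A : Set} (p : A → Bool) (xs : List A) {u} → findᵇ p xs ≡ just u → p u ≡ true
findᵇ-just p (x ∷ xs) e with p x in px
findᵇ-just p (x ∷ xs) refl | true = px
... | false = findᵇ-just p xs e

findᵇ-nothing : ∀ {A : Set} (p : A → Bool) (xs : List A) → findᵇ p xs ≡ nothing → any p xs ≡ false
findᵇ-nothing p []       e = refl
findᵇ-nothing p (x ∷ xs) e with p x
findᵇ-nothing p (x ∷ xs) () | true
... | false = findᵇ-nothing p xs e

all-cong : ∀ {A B : Set} (p : A → Bool) (q : B → Bool) {n} (f : Fin n → A) (g : Fin n → B) →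
           (∀ i → p (f i) ≡ q (g i)) → all p (tabulate f) ≡ all q (tabulate g)
all-cong p q {zero}  f g h = refl
all-cong p q {suc n} f g h = cong₂ _∧_ (h F.zero) (all-cong p q (f ∘ F.suc) (g ∘ F.suc) (h ∘ F.suc))

countB-cong : ∀ {A : Set} {p q : A → Bool} (xs : List A) → (∀ a → p a ≡ q a) →
              countB p xs ≡ countB q xs
countB-cong []       h = refl
countB-cong (x ∷ xs) h rewrite h x | countB-cong xs h = refl

countB-map : ∀ {A B : Set} (p : B → Bool) (g : A → B) (xs : List A) →
             countB p (map g xs) ≡ countB (p ∘ g) xs
countB-map p g []       = refl
countB-map p g (x ∷ xs) rewrite countB-map p g xs = refl

countB-++ : ∀ {A : Set} (p : A → Bool) (xs ys : List A) →
            countB p (xs ++ ys) ≡ countB p xs ℕ.+ countB p ys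
countB-++ p []       ys = refl
countB-++ p (x ∷ xs) ys with p x
... | true  = cong suc (countB-++ p xs ys)
... | false = countB-++ p xs ys

countB-concatMap : ∀ {A B : Set} (p : B → Bool) (g : A → List B) (xs : List A) →
                   countB p (concatMap g xs) ≡ sum (map (λ a → countB p (g a)) xs)
countB-concatMap p g []       = refl
countB-concatMap p g (x ∷ xs) =
  trans (countB-++ p (g x) (concatMap g xs)) (cong (countB p (g x) ℕ.+_) (countB-concatMap p g xs))

countB-guard : ∀ {A : Set} (b : Bool) (p : A → Bool) (xs : List A) →
               countB (λ a → b ∧ p a) xs ≡ (if b then countB p xs else 0)
countB-guard true  p xs       = refl
countB-guard false p []       = refl
countB-guard false p (x ∷ xs) = countB-guard false p xs

sum-indicator : ∀ {A : Set} (c : A → Bool) (K : ℕ) (xs : List A) →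
                sum (map (λ a → if c a then K else 0) xs) ≡ countB c xs ℕ.* K
sum-indicator c K []       = refl
sum-indicator c K (x ∷ xs) with c x
... | true  = cong (K ℕ.+_) (sum-indicator c K xs)
... | false = sum-indicator c K xs

countB-tabulate : ∀ {A : Set} (p : A → Bool) {n} (f : Fin n → A) →
                  countB p (tabulate f) ≡ countB (p ∘ f) (allFin n)
countB-tabulate p f = trans (cong (countB p) (sym (map-tabulate id f))) (countB-map p f (allFin _))

countB-all : ∀ {A : Set} (p : A → Bool) {n} (f : Fin n → A) → (∀ i → p (f i) ≡ true) →
             countB p (tabulate f) ≡ n
countB-all p {zero}  f h = refl
countB-all p {suc n} f h rewrite h F.zero = cong suc (countB-all p (f ∘ F.suc) (h ∘ F.suc))

countB-none : ∀ {A : Set} (p : A → Bool) {n} (f : Fin n → A) → (∀ i → p (f i) ≡ false) →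
              countB p (tabulate f) ≡ 0
countB-none p {zero}  f h = refl
countB-none p {suc n} f h rewrite h F.zero = countB-none p (f ∘ F.suc) (h ∘ F.suc)

countB-≤ : ∀ {A : Set} (p : A → Bool) {n} (f : Fin n → A) → countB p (tabulate f) ≤ n
countB-≤ p {zero}  f = z≤n
countB-≤ p {suc n} f with p (f F.zero)
... | true  = s≤s (countB-≤ p (f ∘ F.suc))
... | false = ℕₚ.m≤n⇒m≤1+n (countB-≤ p (f ∘ F.suc))

countB-mono : ∀ {A : Set} {p q : A → Bool} (xs : List A) → (∀ a → p a ≡ true → q a ≡ true) →
              countB p xs ≤ countB q xs
countB-mono [] h = z≤n
countB-mono {p = p} {q} (x ∷ xs) h with p x in px | q x in qx
... | true  | true  = s≤s (countB-mono xs h)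
... | true  | false = ⊥-elim (true≢false (h x px) qx)
... | false | true  = ℕₚ.m≤n⇒m≤1+n (countB-mono xs h)
... | false | false = countB-mono xs h

countB-strict : ∀ {A : Set} {p q : A → Bool} {n} (f : Fin n → A) → (∀ a → p a ≡ true → q a ≡ true) →
                (i : Fin n) → p (f i) ≡ false → q (f i) ≡ true →
                countB p (tabulate f) < countB q (tabulate f)
countB-strict f h F.zero px qx rewrite px | qx = s≤s (countB-mono (tabulate (f ∘ F.suc)) h)
countB-strict {p = p} {q} f h (F.suc i) px qx with p (f F.zero) in p0 | q (f F.zero) in q0
... | true  | true  = s≤s (countB-strict (f ∘ F.suc) h i px qx)
... | true  | false = ⊥-elim (true≢false (h _ p0) q0)
... | false | true  = ℕₚ.m≤n⇒m≤1+n (countB-strict (f ∘ F.suc) h i px qx)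
... | false | false = countB-strict (f ∘ F.suc) h i px qx

countB-pos : ∀ {A : Set} (p : A → Bool) {n} (f : Fin n → A) (i : Fin n) → p (f i) ≡ true →
             1 ≤ countB p (tabulate f)
countB-pos p f F.zero e rewrite e = s≤s z≤n
countB-pos p f (F.suc i) e with p (f F.zero)
... | true  = s≤s z≤n
... | false = countB-pos p (f ∘ F.suc) i e

-- The enumeration allFuns xs (suc n) lists, for every a ∈ xs and every
-- g ∈ allFuns xs n, the function  cons a g  with value a at 0 and g after.
-- ConsView names this (anonymous) constructor of allFuns; cons a g F.zero
-- and cons a g ∘ F.suc compute to a and g.

record ConsView {A : Set} (xs : List A) (n : ℕ) : Set where
  field
    cons   : A → (Fin n → A) → Fin (suc n) → A
    unfold : allFuns xs (suc n) ≡ concatMap (λ a → map (cons a) (allFuns xs n)) xs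

consView : ∀ {A : Set} (xs : List A) n → ConsView xs n
consView xs n = record { cons = _ ; unfold = refl }

countB-allFuns-suc : ∀ {A : Set} (xs : List A) n (p : (Fin (suc n) → A) → Bool) →
  let open ConsView (consView xs n) in
  countB p (allFuns xs (suc n)) ≡ sum (map (λ a → countB (p ∘ cons a) (allFuns xs n)) xs)
countB-allFuns-suc xs n p = begin
    countB p (allFuns xs (suc n))
  ≡⟨ cong (countB p) unfold ⟩
    countB p (concatMap (λ a → map (cons a) (allFuns xs n)) xs)
  ≡⟨ countB-concatMap p _ xs ⟩
    sum (map (λ a → countB p (map (cons a) (allFuns xs n))) xs)
  ≡⟨ cong sum (map-cong (λ a → countB-map p (cons a) (allFuns xs n)) xs) ⟩
    sum (map (λ a → countB (p ∘ cons a) (allFuns xs n)) xs) ∎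
  where
  open ConsView (consView xs n)
  open ≡-Reasoning

-- The relation  sameComp G X = reachIter G X n  is shown to
-- be an equivalence on X containing the edges of G[X]; transitivity needs
-- that walks of length ≤ n already reach every reachable vertex.

module Walks {n : ℕ} (G : SimpleGraph n) (X : Fin n → Bool) where

  reach : ℕ → Fin n → Fin n → Bool
  reach = reachIter G X

  data LastStep (m : ℕ) (u v : Fin n) : Set where
    shorter : reach m u v ≡ true → LastStep m u v
    via     : ∀ w → reach m u w ≡ true → adj G w v ≡ true → X v ≡ true → LastStep m u v

  lastStep : ∀ m u v → reach (suc m) u v ≡ true → LastStep m u v
  lastStep m u v e with ∨-elim e
  ... | inj₁ e′ = shorter e′
  ... | inj₂ e′ with any-elim (λ w → reach m u w ∧ adj G w v ∧ X v) id e′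
  ... | w , q = via w (∧-elimˡ q) (∧-elimˡ (∧-elimʳ {reach m u w} q)) (∧-elimʳ (∧-elimʳ {reach m u w} q))

  extend : ∀ m u w v → reach m u w ≡ true → adj G w v ≡ true → X v ≡ true → reach (suc m) u v ≡ true
  extend m u w v r a x = ∨-introʳ (any-intro (λ w → reach m u w ∧ adj G w v ∧ X v) id w (∧-intro r (∧-intro a x)))

  reach-refl : ∀ v → X v ≡ true → reach 0 v v ≡ true
  reach-refl v x = ∧-intro x (∧-intro x (==-refl v))

  reach-zero : ∀ u v → reach 0 u v ≡ true → u ≡ v
  reach-zero u v e = ==-sound (∧-elimʳ {X v} (∧-elimʳ {X u} e))

  reach-ends : ∀ m u v → reach m u v ≡ true → X u ≡ true × X v ≡ true
  reach-ends zero    u v e = ∧-elimˡ e , ∧-elimˡ (∧-elimʳ {X u} e)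
  reach-ends (suc m) u v e with lastStep m u v e
  ... | shorter e′    = reach-ends m u v e′
  ... | via w r _ xv = proj₁ (reach-ends m u w r) , xv

  reach-weaken : ∀ k m u v → reach m u v ≡ true → reach (k ℕ.+ m) u v ≡ true
  reach-weaken zero    m u v e = e
  reach-weaken (suc k) m u v e = ∨-introˡ (reach-weaken k m u v e)

  reach-prepend : ∀ m a u v → adj G a u ≡ true → X a ≡ true → reach m u v ≡ true → reach (suc m) a v ≡ true
  reach-prepend zero a u v ad xa e with reach-zero u v e
  ... | refl = extend 0 a a u (reach-refl a xa) ad (proj₁ (reach-ends 0 u u e))
  reach-prepend (suc m) a u v ad xa e with lastStep m u v e
  ... | shorter e′      = ∨-introˡ (reach-prepend m a u v ad xa e′)
  ... | via w r awv xv = extend (suc m) a w v (reach-prepend m a u w ad xa r) awv xv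

  reach-sym : ∀ m u v → reach m u v ≡ true → reach m v u ≡ true
  reach-sym zero u v e with reach-zero u v e
  ... | refl = e
  reach-sym (suc m) u v e with lastStep m u v e
  ... | shorter e′     = ∨-introˡ (reach-sym m u v e′)
  ... | via w r wv xv = reach-prepend m v w u (trans (SimpleGraph.sym G v w) wv) xv (reach-sym m u w r)

  reach-trans : ∀ b a u w v → reach a u w ≡ true → reach b w v ≡ true → reach (b ℕ.+ a) u v ≡ true
  reach-trans zero a u w v e₁ e₂ with reach-zero w v e₂
  ... | refl = e₁
  reach-trans (suc b) a u w v e₁ e₂ with lastStep b w v e₂
  ... | shorter e′     = ∨-introˡ (reach-trans b a u w v e₁ e′)
  ... | via z r zv xv = extend (b ℕ.+ a) u z v (reach-trans b a u w z e₁ r) zv xv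

  -- The balls  ball m = {v | reach m u v}  grow with m; once a
  -- ball stops growing it is closed for good, and while the balls grow the
  -- m-th one has more than m elements, so the ball of radius n is closed.
  module Saturation (u : Fin n) (xu : X u ≡ true) where

    ball : ℕ → Fin n → Bool
    ball m = reach m u

    Closed : ℕ → Set
    Closed m = ∀ k v → ball (k ℕ.+ m) v ≡ true → ball m v ≡ true

    closed-if-stalls : ∀ m → (∀ v → ball (suc m) v ≡ true → ball m v ≡ true) → Closed m
    closed-if-stalls m stall zero    v e = e
    closed-if-stalls m stall (suc k) v e with lastStep (k ℕ.+ m) u v e
    ... | shorter e′     = closed-if-stalls m stall k v e′
    ... | via w r wv xv = stall v (extend m u w v (closed-if-stalls m stall k w r) wv xv)

    closed-suc : ∀ m → Closed m → Closed (suc m)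
    closed-suc m closed k v e rewrite ℕₚ.+-suc k m = ∨-introˡ (closed (suc k) v e)

    closed-or-large : ∀ m → Closed m ⊎ m < countB (ball m) (allFin n)
    closed-or-large zero = inj₂ (countB-pos (ball 0) id u (reach-refl u xu))
    closed-or-large (suc m) with closed-or-large m
    ... | inj₁ closed = inj₁ (closed-suc m closed)
    ... | inj₂ large with any (λ v → ball (suc m) v ∧ not (ball m v)) (allFin n) in grows
    ... | true = let v , new = any-elim (λ v → ball (suc m) v ∧ not (ball m v)) id grows in
      inj₂ (ℕₚ.≤-trans (s≤s large)
                       (countB-strict id (λ _ → ∨-introˡ) v (not-true (∧-elimʳ {ball (suc m) v} new)) (∧-elimˡ new)))
    ... | false = inj₁ (closed-suc m (closed-if-stalls m stall))
      where
      stall : ∀ v → ball (suc m) v ≡ true → ball m v ≡ true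
      stall v e with none-elim (λ v → ball (suc m) v ∧ not (ball m v)) id grows v
      ... | old rewrite e = not-false old

    saturate : ∀ m v → ball m v ≡ true → ball n v ≡ true
    saturate m v e with closed-or-large n
    ... | inj₂ large  = ⊥-elim (ℕₚ.<-irrefl refl (ℕₚ.<-≤-trans large (countB-≤ (ball n) id)))
    ... | inj₁ closed = closed m v (subst (λ k → ball k v ≡ true) (ℕₚ.+-comm n m) (reach-weaken n m u v e))

  sameComp-saturate : ∀ m u v → reach m u v ≡ true → sameComp G X u v ≡ true
  sameComp-saturate m u v e = Saturation.saturate u (proj₁ (reach-ends m u v e)) m v e

  sameComp-ends : ∀ u v → sameComp G X u v ≡ true → X u ≡ true × X v ≡ true
  sameComp-ends = reach-ends n

  sameComp-sym : ∀ u v → sameComp G X u v ≡ true → sameComp G X v u ≡ true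
  sameComp-sym = reach-sym n

  sameComp-trans : ∀ u w v → sameComp G X u w ≡ true → sameComp G X w v ≡ true → sameComp G X u v ≡ true
  sameComp-trans u w v e₁ e₂ = sameComp-saturate (n ℕ.+ n) u v (reach-trans n n u w v e₁ e₂)

  sameComp-edge : ∀ u v → adj G u v ≡ true → X u ≡ true → X v ≡ true → sameComp G X u v ≡ true
  sameComp-edge u v a xu xv = sameComp-saturate 1 u v (extend 0 u u v (reach-refl u xu) a xv)

-- If every vertex carries a constraint and copies only refer
-- to earlier vertices, the solutions h are built vertex by vertex with 1 or y
-- choices each, so there are  y ^ (number of nonzero-constraints)  of them.

data Constraint (y n : ℕ) : Set where
  vanish  : Constraint y n
  fixed   : Fin (suc y) → Constraint y n
  nonzero : Constraint y n
  copy    : Fin n → Constraint y n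

System : ℕ → ℕ → Set
System y n = Fin n → Constraint y n

obeys : ∀ {y n} → Constraint y n → Fin (suc y) → (Fin n → Fin (suc y)) → Bool
obeys vanish    a h = a ==ᶠ F.zero
obeys (fixed b) a h = a ==ᶠ b
obeys nonzero   a h = not (a ==ᶠ F.zero)
obeys (copy u)  a h = a ==ᶠ h u

solves : ∀ {y n} → System y n → (Fin n → Fin (suc y)) → Bool
solves {n = n} sys h = all (λ v → obeys (sys v) (h v) h) (allFin n)

Sequential : ∀ {y n} → System y n → Set
Sequential sys = ∀ v u → sys v ≡ copy u → toℕ u < toℕ v

isNonzero : ∀ {y n} → Constraint y n → Bool
isNonzero nonzero = true
isNonzero _       = false

nonzeroCount : ∀ {y n} → System y n → ℕ
nonzeroCount {n = n} sys = countB (isNonzero ∘ sys) (allFin n)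

choices : ∀ {y n} → Constraint y n → Fin (suc y) → Bool
choices vanish    a = a ==ᶠ F.zero
choices (fixed b) a = a ==ᶠ b
choices nonzero   a = not (a ==ᶠ F.zero)
choices (copy _)  a = false

shift : ∀ {y n} → Fin (suc y) → Constraint y (suc n) → Constraint y n
shift a vanish            = vanish
shift a (fixed b)         = fixed b
shift a nonzero           = nonzero
shift a (copy F.zero)     = fixed a
shift a (copy (F.suc u))  = copy u

fix0 : ∀ {y n} → System y (suc n) → Fin (suc y) → System y n
fix0 sys a = shift a ∘ sys ∘ F.suc

obeys-shift : ∀ {y n} (c : Constraint y (suc n)) a (h : Fin (suc n) → Fin (suc y)) →
              obeys c a h ≡ obeys (shift (h F.zero) c) a (h ∘ F.suc)
obeys-shift vanish           a h = refl
obeys-shift (fixed b)        a h = refl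
obeys-shift nonzero          a h = refl
obeys-shift (copy F.zero)    a h = refl
obeys-shift (copy (F.suc u)) a h = refl

isNonzero-shift : ∀ {y n} a (c : Constraint y (suc n)) → isNonzero (shift a c) ≡ isNonzero c
isNonzero-shift a vanish           = refl
isNonzero-shift a (fixed b)        = refl
isNonzero-shift a nonzero          = refl
isNonzero-shift a (copy F.zero)    = refl
isNonzero-shift a (copy (F.suc u)) = refl

obeys-choices : ∀ {y n} (c : Constraint y n) → (∀ u → c ≢ copy u) → ∀ a h → obeys c a h ≡ choices c a
obeys-choices vanish    _  a h = refl
obeys-choices (fixed b) _  a h = refl
obeys-choices nonzero   _  a h = refl
obeys-choices (copy u)  ne a h = ⊥-elim (ne u refl)

countB-== : ∀ {k} (b : Fin k) → countB (_==ᶠ b) (allFin k) ≡ 1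
countB-== {suc k} F.zero    = cong suc (countB-none (_==ᶠ F.zero) {k} F.suc (λ _ → refl))
countB-== {suc k} (F.suc b) = begin
    countB (_==ᶠ F.suc b) (tabulate F.suc)         ≡⟨ countB-tabulate (_==ᶠ F.suc b) F.suc ⟩
    countB (λ i → F.suc i ==ᶠ F.suc b) (allFin k)  ≡⟨ countB-cong (allFin k) (λ i → ==-suc i b) ⟩
    countB (_==ᶠ b) (allFin k)                     ≡⟨ countB-== b ⟩
    1                                              ∎
  where open ≡-Reasoning

choices-count : ∀ {y n} (c : Constraint y n) → (∀ u → c ≢ copy u) →
                countB (choices c) (allFin (suc y)) ≡ (if isNonzero c then y else 1)
choices-count {y} vanish    _  = countB-== {suc y} F.zero
choices-count     (fixed b) _  = countB-== b
choices-count {y} nonzero   _  = countB-all (λ a → not (a ==ᶠ F.zero)) {y} F.suc (λ _ → refl)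
choices-count     (copy u)  ne = ⊥-elim (ne u refl)

module _ {y n : ℕ} (sys : System y (suc n)) where

  tailCount : ℕ
  tailCount = countB (isNonzero ∘ sys ∘ F.suc) (allFin n)

  nonzeroCount-fix0 : ∀ a → nonzeroCount (fix0 sys a) ≡ tailCount
  nonzeroCount-fix0 a = countB-cong (allFin n) (λ i → isNonzero-shift a (sys (F.suc i)))

  nonzeroCount-head : y ^ nonzeroCount sys ≡ (if isNonzero (sys F.zero) then y else 1) ℕ.* y ^ tailCount
  nonzeroCount-head rewrite sym (countB-tabulate (isNonzero ∘ sys) F.suc) = split (isNonzero (sys F.zero)) _
    where
    split : ∀ b (N : ℕ) → y ^ (if b then suc N else N) ≡ (if b then y else 1) ℕ.* y ^ N
    split true  N = refl
    split false N = sym (ℕₚ.*-identityˡ (y ^ N))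

module _ {y n : ℕ} (sys : System y (suc n)) (seq : Sequential sys) where

  head-not-copy : ∀ u → sys F.zero ≢ copy u
  head-not-copy u e = ℕₚ.n≮0 (seq F.zero u e)

  sequential-fix0 : ∀ a → Sequential (fix0 sys a)
  sequential-fix0 a i r e with sys (F.suc i) in eq
  sequential-fix0 a i r () | vanish
  sequential-fix0 a i r () | fixed _
  sequential-fix0 a i r () | nonzero
  sequential-fix0 a i r () | copy F.zero
  sequential-fix0 a i r refl | copy (F.suc r) = ℕₚ.≤-pred (seq (F.suc i) (F.suc r) eq)

  solves-head : ∀ h → solves sys h ≡ choices (sys F.zero) (h F.zero) ∧ solves (fix0 sys (h F.zero)) (h ∘ F.suc)
  solves-head h =
    cong₂ _∧_ (obeys-choices (sys F.zero) head-not-copy (h F.zero) h)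
              (all-cong _ _ F.suc id (λ i → obeys-shift (sys (F.suc i)) (h (F.suc i)) h))

solutions-count : ∀ {y} n (sys : System y n) → Sequential sys →
                  countB (solves sys) (allFuns (allFin (suc y)) n) ≡ y ^ nonzeroCount sys
solutions-count zero sys seq = refl
solutions-count {y} (suc n) sys seq = begin
    countB (solves sys) (allFuns V (suc n))
  ≡⟨ countB-allFuns-suc V n (solves sys) ⟩
    sum (map (λ a → countB (solves sys ∘ cons a) (allFuns V n)) V)
  ≡⟨ cong sum (map-cong per-value V) ⟩
    sum (map (λ a → if choices c a then y ^ N else 0) V)
  ≡⟨ sum-indicator (choices c) (y ^ N) V ⟩
    countB (choices c) V ℕ.* y ^ N
  ≡⟨ cong (ℕ._* y ^ N) (choices-count c (head-not-copy sys seq)) ⟩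
    (if isNonzero c then y else 1) ℕ.* y ^ N
  ≡⟨ sym (nonzeroCount-head sys) ⟩
    y ^ nonzeroCount sys ∎
  where
  open ≡-Reasoning
  open ConsView (consView (allFin (suc y)) n)

  V : List (Fin (suc y))
  V = allFin (suc y)

  c : Constraint y (suc n)
  c = sys F.zero

  N : ℕ
  N = tailCount sys

  per-value : ∀ a → countB (solves sys ∘ cons a) (allFuns V n) ≡ (if choices c a then y ^ N else 0)
  per-value a = begin
      countB (solves sys ∘ cons a) (allFuns V n)
    ≡⟨ countB-cong (allFuns V n) (λ g → solves-head sys seq (cons a g)) ⟩
      countB (λ g → choices c a ∧ solves (fix0 sys a) g) (allFuns V n)
    ≡⟨ countB-guard (choices c a) (solves (fix0 sys a)) (allFuns V n) ⟩
      (if choices c a then countB (solves (fix0 sys a)) (allFuns V n) else 0)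
    ≡⟨ cong (if choices c a then_else 0) (solutions-count n (fix0 sys a) (sequential-fix0 sys seq a)) ⟩
      (if choices c a then y ^ nonzeroCount (fix0 sys a) else 0)
    ≡⟨ cong (λ k → if choices c a then y ^ k else 0) (nonzeroCount-fix0 sys a) ⟩
      (if choices c a then y ^ N else 0) ∎

starAdj-zeroˡ : ∀ {y} (b : Fin (suc y)) → starAdj F.zero b ≡ true
starAdj-zeroˡ b = ∨-introʳ {F.zero ==ᶠ b} refl

starAdj-zeroʳ : ∀ {y} (a : Fin (suc y)) → starAdj a F.zero ≡ true
starAdj-zeroʳ a = ∨-introʳ {a ==ᶠ F.zero} (∨-introʳ {a ==ᶠ F.zero} refl)

starAdj-refl : ∀ {y} (a : Fin (suc y)) → starAdj a a ≡ true
starAdj-refl a = ∨-introˡ (==-refl a)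

starAdj-intro : ∀ {y} (a b : Fin (suc y)) → (a ≢ F.zero → b ≢ F.zero → a ≡ b) → starAdj a b ≡ true
starAdj-intro F.zero    b         _   = starAdj-zeroˡ b
starAdj-intro (F.suc a) F.zero    _   = starAdj-zeroʳ (F.suc a)
starAdj-intro (F.suc a) (F.suc b) a=b =
  subst (λ c → starAdj (F.suc a) c ≡ true) (a=b (λ ()) (λ ())) (starAdj-refl (F.suc a))

starAdj-nonzero : ∀ {y} (a b : Fin (suc y)) → a ≢ F.zero → b ≢ F.zero → starAdj a b ≡ true → a ≡ b
starAdj-nonzero a b a≢0 b≢0 e with ∨-elim {a ==ᶠ b} e
... | inj₁ a=b = ==-sound a=b
... | inj₂ e′ with ∨-elim {a ==ᶠ F.zero} e′
...   | inj₁ a=0 = ⊥-elim (a≢0 (==-sound a=0))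
...   | inj₂ b=0 = ⊥-elim (b≢0 (==-sound b=0))

module _ {n y : ℕ} (G : SimpleGraph n) (h : Fin n → Fin (suc y)) where

  isHom-sound : isHom G h ≡ true → ∀ u v → adj G u v ≡ true → starAdj (h u) (h v) ≡ true
  isHom-sound hom u v uv = not-false (subst (λ b → b ∧ not (starAdj (h u) (h v)) ≡ false) uv
    (none-elim (λ v → adj G u v ∧ not (starAdj (h u) (h v))) id
      (none-elim (λ u → any (λ v → adj G u v ∧ not (starAdj (h u) (h v))) (allFin n)) id (not-true hom) u) v))

  isHom-complete : (∀ u v → adj G u v ≡ true → starAdj (h u) (h v) ≡ true) → isHom G h ≡ true
  isHom-complete H = not-intro (none-intro _ id λ u → none-intro _ id λ v → edge-ok u v (adj G u v) refl)
    where
    edge-ok : ∀ u v b → adj G u v ≡ b → b ∧ not (starAdj (h u) (h v)) ≡ false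
    edge-ok u v false _ = refl
    edge-ok u v true uv rewrite H u v uv = refl

support : ∀ {n y} → (Fin n → Fin (suc y)) → Fin n → Bool
support h v = not (h v ==ᶠ F.zero)

support-nonzero : ∀ {n y} (h : Fin n → Fin (suc y)) v → support h v ≡ true → h v ≢ F.zero
support-nonzero {y = y} h v e hv=0 =
  true≢false (subst (λ a → (a ==ᶠ F.zero) ≡ true) (sym hv=0) (==-refl (F.zero {y}))) (not-true e)

support-of-nonzero : ∀ {n y} (h : Fin n → Fin (suc y)) v → h v ≢ F.zero → support h v ≡ true
support-of-nonzero h v ne = not-intro (==-refute ne)

sameSubset : ∀ {n} → (Fin n → Bool) → (Fin n → Bool) → Bool
sameSubset {n} S X = all (λ v → ⌊ S v Boolₚ.≟ X v ⌋) (allFin n)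

sameSubset-sound : ∀ {n} (S X : Fin n → Bool) → sameSubset S X ≡ true → ∀ v → S v ≡ X v
sameSubset-sound S X e v = ⌊⌋-sound (S v Boolₚ.≟ X v) (all-elim _ id e v)

sameSubset-complete : ∀ {n} (S X : Fin n → Bool) → (∀ v → S v ≡ X v) → sameSubset S X ≡ true
sameSubset-complete S X h = all-intro _ id (λ v → ⌊⌋-complete (S v Boolₚ.≟ X v) (h v))

-- Homomorphisms with a given support.  h : V → Star_y is a homomorphism with
-- support X iff h vanishes off X and is nonzero and constant on every
-- component of G[X].  These maps are the solutions of the sequential system
-- in which a vertex of X copies the least vertex of its component when that
-- vertex is earlier, and is merely nonzero when it is itself the least one.
-- The nonzero-constraints sit at the component minima, so there are
-- y ^ components G X such homomorphisms.

module ComponentSystem {n : ℕ} (G : SimpleGraph n) (X : Fin n → Bool) (y : ℕ) where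
  open Walks G X

  earlierMate : Fin n → Fin n → Bool
  earlierMate v u = (toℕ u <ᵇ toℕ v) ∧ sameComp G X u v

  copyOrNonzero : Maybe (Fin n) → Constraint y n
  copyOrNonzero (just u) = copy u
  copyOrNonzero nothing  = nonzero

  insideConstraint : Fin n → Constraint y n
  insideConstraint v = copyOrNonzero (findᵇ (earlierMate v) (allFin n))

  system : System y n
  system v = if X v then insideConstraint v else vanish

  system-byX : ∀ v {b} → X v ≡ b → system v ≡ (if b then insideConstraint v else vanish)
  system-byX v = cong (if_then insideConstraint v else vanish)

  data Role (v : Fin n) : Set where
    outside  : X v ≡ false → system v ≡ vanish → Role v
    minimum  : X v ≡ true → system v ≡ nonzero → (∀ u → earlierMate v u ≡ false) → Role v
    follower : ∀ u → X v ≡ true → system v ≡ copy u → earlierMate v u ≡ true → Role v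

  role : ∀ v → Role v
  role v with X v in xv
  ... | false = outside xv (system-byX v xv)
  ... | true with findᵇ (earlierMate v) (allFin n) in found
  ...   | nothing = minimum xv (trans (system-byX v xv) (cong copyOrNonzero found))
                      (none-elim (earlierMate v) id (findᵇ-nothing (earlierMate v) (allFin n) found))
  ...   | just u  = follower u xv (trans (system-byX v xv) (cong copyOrNonzero found))
                      (findᵇ-just (earlierMate v) (allFin n) found)

  earlierMate-< : ∀ v u → earlierMate v u ≡ true → toℕ u < toℕ v
  earlierMate-< v u e = ℕₚ.<ᵇ⇒< (toℕ u) (toℕ v) (Equivalence.from Boolₚ.T-≡ (∧-elimˡ e))

  earlierMate-sameComp : ∀ v u → earlierMate v u ≡ true → sameComp G X u v ≡ true
  earlierMate-sameComp v u = ∧-elimʳ {toℕ u <ᵇ toℕ v}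

  sequential : Sequential system
  sequential v u e with role v
  ... | outside _ s with trans (sym s) e
  ...   | ()
  sequential v u e | minimum _ s _ with trans (sym s) e
  ...   | ()
  sequential v u e | follower w _ s m with trans (sym s) e
  ...   | refl = earlierMate-< v w m

  isNonzero-find : (p : Fin n → Bool) (xs : List (Fin n)) →
                   isNonzero (copyOrNonzero (findᵇ p xs)) ≡ not (any p xs)
  isNonzero-find p []       = refl
  isNonzero-find p (x ∷ xs) with p x
  ... | true  = refl
  ... | false = isNonzero-find p xs

  nonzeroCount-system : nonzeroCount system ≡ components G X
  nonzeroCount-system = countB-cong (allFin n) isNonzero-at
    where
    isNonzero-at : ∀ v → isNonzero (system v) ≡ X v ∧ not (any (earlierMate v) (allFin n))
    isNonzero-at v with X v
    ... | false = refl
    ... | true  = isNonzero-find (earlierMate v) (allFin n)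

  -- A homomorphism with support X solves the system: it is constant along
  -- walks in G[X], since adjacent vertices off v₀ have equal images.
  module FromHom (h : Fin n → Fin (suc y)) (hom : isHom G h ≡ true) (supp : ∀ v → support h v ≡ X v) where

    nonzero-on-X : ∀ v → X v ≡ true → h v ≢ F.zero
    nonzero-on-X v xv = support-nonzero h v (trans (supp v) xv)

    constant-on-walks : ∀ m u v → reach m u v ≡ true → h u ≡ h v
    constant-on-walks zero    u v e = cong h (reach-zero u v e)
    constant-on-walks (suc m) u v e with lastStep m u v e
    ... | shorter e′     = constant-on-walks m u v e′
    ... | via w r wv xv =
      trans (constant-on-walks m u w r)
            (starAdj-nonzero (h w) (h v) (nonzero-on-X w (proj₂ (reach-ends m u w r))) (nonzero-on-X v xv)
                             (isHom-sound G h hom w v wv))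

    obeys-at : ∀ v → obeys (system v) (h v) h ≡ true
    obeys-at v with role v
    ... | outside xv s    rewrite s = not-false (trans (supp v) xv)
    ... | minimum xv s _  rewrite s = trans (supp v) xv
    ... | follower u _ s m rewrite s | constant-on-walks n u v (earlierMate-sameComp v u m) = ==-refl (h v)

    solution : solves system h ≡ true
    solution = all-intro _ id obeys-at

  -- Conversely a solution vanishes exactly off X and is constant on
  -- components, hence maps every edge to an edge of Star_y.
  module FromSolution (h : Fin n → Fin (suc y)) (sol : solves system h ≡ true) where

    obeys-at : ∀ v {c} → system v ≡ c → obeys c (h v) h ≡ true
    obeys-at v e = subst (λ c → obeys c (h v) h ≡ true) e (all-elim _ id sol v)

    copies : ∀ v u → system v ≡ copy u → h v ≡ h u
    copies v u s = ==-sound (obeys-at v s)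

    -- following copy links downwards ends at a component minimum, which is nonzero
    nonzero-below : ∀ k v → toℕ v < k → X v ≡ true → h v ≢ F.zero
    nonzero-below (suc k) v v<k xv with role v
    ... | outside xf _     = ⊥-elim (true≢false xv xf)
    ... | minimum _ s _    = support-nonzero h v (obeys-at v s)
    ... | follower u _ s m = λ hv=0 →
      nonzero-below k u (ℕₚ.≤-trans (earlierMate-< v u m) (ℕₚ.≤-pred v<k))
                        (proj₁ (sameComp-ends u v (earlierMate-sameComp v u m)))
                        (trans (sym (copies v u s)) hv=0)

    nonzero-on-X : ∀ v → X v ≡ true → h v ≢ F.zero
    nonzero-on-X v = nonzero-below (suc (toℕ v)) v ℕₚ.≤-refl

    support-is-X : ∀ v → support h v ≡ X v
    support-is-X v with role v
    ... | outside xf s       = trans (cong not (obeys-at v s)) (sym xf)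
    ... | minimum xv _ _     = trans (support-of-nonzero h v (nonzero-on-X v xv)) (sym xv)
    ... | follower _ xv _ _  = trans (support-of-nonzero h v (nonzero-on-X v xv)) (sym xv)

    Below : ℕ → Set
    Below k = ∀ v → toℕ v < k → ∀ u → toℕ u ≤ toℕ v → sameComp G X u v ≡ true → h u ≡ h v

    unordered : ∀ {k} → Below k → ∀ u v → toℕ u < k → toℕ v < k → sameComp G X u v ≡ true → h u ≡ h v
    unordered below u v u<k v<k uv with ℕₚ.≤-<-connex (toℕ u) (toℕ v)
    ... | inj₁ u≤v = below v v<k u u≤v uv
    ... | inj₂ v<u = sym (below u u<k v (ℕₚ.<⇒≤ v<u) (sameComp-sym u v uv))

    -- a vertex v with an earlier mate u copies its least earlier mate w,
    -- and u, w are mates below v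
    below : ∀ k → Below k
    below (suc k) v v<k u u≤v uv with ℕₚ.m≤n⇒m<n∨m≡n u≤v
    ... | inj₂ u=v rewrite Finₚ.toℕ-injective u=v = refl
    ... | inj₁ u<v with role v
    ...   | outside xf _     = ⊥-elim (true≢false (proj₂ (sameComp-ends u v uv)) xf)
    ...   | minimum _ _ none =
      ⊥-elim (true≢false (∧-intro (Equivalence.to Boolₚ.T-≡ (ℕₚ.<⇒<ᵇ u<v)) uv) (none u))
    ...   | follower w _ s m =
      trans (unordered (below k) u w (ℕₚ.≤-trans u<v (ℕₚ.≤-pred v<k))
                                     (ℕₚ.≤-trans (earlierMate-< v w m) (ℕₚ.≤-pred v<k))
                                     (sameComp-trans u v w uv (sameComp-sym w v (earlierMate-sameComp v w m))))
            (sym (copies v w s))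

    constant-on-components : ∀ u v → sameComp G X u v ≡ true → h u ≡ h v
    constant-on-components u v = unordered (below n) u v (Finₚ.toℕ<n u) (Finₚ.toℕ<n v)

    in-X : ∀ v → h v ≢ F.zero → X v ≡ true
    in-X v ne = trans (sym (support-is-X v)) (support-of-nonzero h v ne)

    homomorphism : isHom G h ≡ true
    homomorphism = isHom-complete G h λ u v uv → starAdj-intro (h u) (h v) λ hu≢0 hv≢0 →
      constant-on-components u v (sameComp-edge u v uv (in-X u hu≢0) (in-X v hv≢0))

  solves-iff : ∀ h → solves system h ≡ isHom G h ∧ sameSubset (support h) X
  solves-iff h = bool-ext
    (λ sol → ∧-intro (FromSolution.homomorphism h sol)
                     (sameSubset-complete (support h) X (FromSolution.support-is-X h sol)))
    (λ e → FromHom.solution h (∧-elimˡ e) (sameSubset-sound (support h) X (∧-elimʳ {isHom G h} e)))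

  hom-count : countB (λ h → isHom G h ∧ sameSubset (support h) X) (allFuns (allFin (suc y)) n)
              ≡ y ^ components G X
  hom-count = begin
      countB (λ h → isHom G h ∧ sameSubset (support h) X) (allFuns (allFin (suc y)) n)
    ≡⟨ countB-cong (allFuns (allFin (suc y)) n) (λ h → sym (solves-iff h)) ⟩
      countB (solves system) (allFuns (allFin (suc y)) n)
    ≡⟨ solutions-count n system sequential ⟩
      y ^ nonzeroCount system
    ≡⟨ cong (y ^_) nonzeroCount-system ⟩
      y ^ components G X ∎
    where open ≡-Reasoning

module Sums {c ℓ : Level} (R : CommutativeSemiring c ℓ) where
  open CommutativeSemiring R renaming (refl to ≈-refl; sym to ≈-sym; trans to ≈-trans) hiding (zero)
  open import Relation.Binary.Reasoning.Setoid setoid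
  open import Algebra.Properties.CommutativeSemigroup +-commutativeSemigroup using (interchange)

  ∑ : {A : Set} → (A → Carrier) → List A → Carrier
  ∑ = sumR R

  ∑-cong : ∀ {A : Set} {f g : A → Carrier} (xs : List A) → (∀ a → f a ≈ g a) → ∑ f xs ≈ ∑ g xs
  ∑-cong []       h = ≈-refl
  ∑-cong (x ∷ xs) h = +-cong (h x) (∑-cong xs h)

  ∑-zero : ∀ {A : Set} (f : A → Carrier) (xs : List A) → (∀ a → f a ≈ 0#) → ∑ f xs ≈ 0#
  ∑-zero f []       h = ≈-refl
  ∑-zero f (x ∷ xs) h = ≈-trans (+-cong (h x) (∑-zero f xs h)) (+-identityˡ 0#)

  ∑-++ : ∀ {A : Set} (f : A → Carrier) (xs ys : List A) → ∑ f (xs ++ ys) ≈ ∑ f xs + ∑ f ys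
  ∑-++ f []       ys = ≈-sym (+-identityˡ _)
  ∑-++ f (x ∷ xs) ys = ≈-trans (+-cong ≈-refl (∑-++ f xs ys)) (≈-sym (+-assoc _ _ _))

  ∑-map : ∀ {A B : Set} (f : B → Carrier) (g : A → B) (xs : List A) → ∑ f (map g xs) ≡ ∑ (f ∘ g) xs
  ∑-map f g []       = refl
  ∑-map f g (x ∷ xs) = cong (f (g x) +_) (∑-map f g xs)

  ∑-concatMap : ∀ {A B : Set} (f : B → Carrier) (g : A → List B) (xs : List A) →
                ∑ f (concatMap g xs) ≈ ∑ (λ a → ∑ f (g a)) xs
  ∑-concatMap f g []       = ≈-refl
  ∑-concatMap f g (x ∷ xs) = ≈-trans (∑-++ f (g x) (concatMap g xs)) (+-cong ≈-refl (∑-concatMap f g xs))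

  ∑-+ : ∀ {A : Set} (f g : A → Carrier) (xs : List A) → ∑ f xs + ∑ g xs ≈ ∑ (λ a → f a + g a) xs
  ∑-+ f g []       = +-identityˡ 0#
  ∑-+ f g (x ∷ xs) = ≈-trans (interchange _ _ _ _) (+-cong ≈-refl (∑-+ f g xs))

  ∑-swap : ∀ {A B : Set} (F : A → B → Carrier) (xs : List A) (ys : List B) →
           ∑ (λ a → ∑ (F a) ys) xs ≈ ∑ (λ b → ∑ (λ a → F a b) xs) ys
  ∑-swap F []       ys = ≈-sym (∑-zero _ ys (λ _ → ≈-refl))
  ∑-swap F (x ∷ xs) ys = ≈-trans (+-cong ≈-refl (∑-swap F xs ys)) (∑-+ (F x) (λ b → ∑ (λ a → F a b) xs) ys)

  ∑-count : ∀ {A : Set} (c : Carrier) (p : A → Bool) (xs : List A) →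
            c * fromℕ R (countB p xs) ≈ ∑ (λ a → if p a then c else 0#) xs
  ∑-count c p []       = zeroʳ c
  ∑-count c p (x ∷ xs) with p x
  ... | true  = ≈-trans (distribˡ c 1# _) (+-cong (*-identityʳ c) (∑-count c p xs))
  ... | false = ≈-trans (∑-count c p xs) (≈-sym (+-identityˡ _))

  ∑-guard : ∀ {A : Set} (b : Bool) (e : A → Bool) (g : A → Carrier) (xs : List A) →
            ∑ (λ a → if b ∧ e a then g a else 0#) xs ≈ (if b then ∑ (λ a → if e a then g a else 0#) xs else 0#)
  ∑-guard true  e g xs = ≈-refl
  ∑-guard false e g xs = ∑-zero _ xs (λ _ → ≈-refl)

  if-cong : ∀ b {a a′} → a ≈ a′ → (if b then a else 0#) ≈ (if b then a′ else 0#)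
  if-cong true  e = e
  if-cong false e = ≈-refl

  ∑-allFuns-suc : ∀ {A : Set} (xs : List A) n (F : (Fin (suc n) → A) → Carrier) →
    let open ConsView (consView xs n) in
    ∑ F (allFuns xs (suc n)) ≈ ∑ (λ a → ∑ (F ∘ cons a) (allFuns xs n)) xs
  ∑-allFuns-suc xs n F = begin
      ∑ F (allFuns xs (suc n))
    ≡⟨ cong (∑ F) unfold ⟩
      ∑ F (concatMap (λ a → map (cons a) (allFuns xs n)) xs)
    ≈⟨ ∑-concatMap F _ xs ⟩
      ∑ (λ a → ∑ F (map (cons a) (allFuns xs n))) xs
    ≈⟨ ∑-cong xs (λ a → reflexive (∑-map F (cons a) (allFuns xs n))) ⟩
      ∑ (λ a → ∑ (F ∘ cons a) (allFuns xs n)) xs ∎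
    where open ConsView (consView xs n)

  Extensional : ∀ {n} → ((Fin n → Bool) → Carrier) → Set ℓ
  Extensional g = ∀ X X′ → (∀ i → X i ≡ X′ i) → g X ≈ g X′

  ∑-subset-indicator : ∀ n (S : Fin n → Bool) (g : (Fin n → Bool) → Carrier) → Extensional g →
                       ∑ (λ X → if sameSubset S X then g X else 0#) (allSubsets n) ≈ g S
  ∑-subset-indicator zero    S g ext = ≈-trans (+-identityʳ _) (ext _ _ (λ ()))
  ∑-subset-indicator (suc n) S g ext = begin
      ∑ T (allSubsets (suc n))
    ≈⟨ ∑-allFuns-suc bits n T ⟩
      ∑ (λ a → ∑ (T ∘ cons a) (allSubsets n)) bits
    ≈⟨ ∑-cong bits (λ a → ∑-cong (allSubsets n) (λ X →
         reflexive (cong (if_then g (cons a X) else 0#) (sameSubset-cons a X)))) ⟩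
      ∑ (λ a → ∑ (λ X → if ⌊ S F.zero Boolₚ.≟ a ⌋ ∧ sameSubset (S ∘ F.suc) X then g (cons a X) else 0#)
                 (allSubsets n)) bits
    ≈⟨ ∑-cong bits (λ a → ≈-trans (∑-guard ⌊ S F.zero Boolₚ.≟ a ⌋ (sameSubset (S ∘ F.suc)) (g ∘ cons a) (allSubsets n))
                                  (if-cong ⌊ S F.zero Boolₚ.≟ a ⌋ (∑-subset-indicator n (S ∘ F.suc) (g ∘ cons a) (ext-cons a)))) ⟩
      ∑ (λ a → if ⌊ S F.zero Boolₚ.≟ a ⌋ then g (cons a (S ∘ F.suc)) else 0#) bits
    ≈⟨ pick (S F.zero) (λ a → g (cons a (S ∘ F.suc))) ⟩
      g (cons (S F.zero) (S ∘ F.suc))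
    ≈⟨ ext _ _ (λ { F.zero → refl ; (F.suc i) → refl }) ⟩
      g S ∎
    where
    open ConsView (consView (true ∷ false ∷ []) n)

    bits : List Bool
    bits = true ∷ false ∷ []

    T : (Fin (suc n) → Bool) → Carrier
    T X = if sameSubset S X then g X else 0#

    sameSubset-cons : ∀ a X → sameSubset S (cons a X) ≡ ⌊ S F.zero Boolₚ.≟ a ⌋ ∧ sameSubset (S ∘ F.suc) X
    sameSubset-cons a X = cong (⌊ S F.zero Boolₚ.≟ a ⌋ ∧_)
      (all-cong (λ v → ⌊ S v Boolₚ.≟ cons a X v ⌋) (λ v → ⌊ S (F.suc v) Boolₚ.≟ X v ⌋) F.suc id (λ i → refl))

    ext-cons : ∀ a → Extensional (g ∘ cons a)
    ext-cons a X X′ e = ext _ _ (λ { F.zero → refl ; (F.suc i) → e i })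

    pick : ∀ s (G : Bool → Carrier) → ∑ (λ a → if ⌊ s Boolₚ.≟ a ⌋ then G a else 0#) bits ≈ G s
    pick true  G = ≈-trans (+-cong ≈-refl (+-identityʳ 0#)) (+-identityʳ (G true))
    pick false G = ≈-trans (+-identityˡ _) (+-identityʳ (G false))

module Weights {c ℓ : Level} (R : CommutativeSemiring c ℓ) (x : CommutativeSemiring.Carrier R) where
  open CommutativeSemiring R renaming (refl to ≈-refl; sym to ≈-sym; trans to ≈-trans) hiding (zero)

  ∏ : {A : Set} → (A → Carrier) → List A → Carrier
  ∏ = prodR R

  ∏-α : ∀ {n y} (h : Fin n → Fin (suc y)) (vs : List (Fin n)) →
        ∏ (λ v → α R x (h v)) vs ≈ powR R x (countB (support h) vs)
  ∏-α h []       = ≈-refl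
  ∏-α h (v ∷ vs) = factor (h v) (∏-α h vs)
    where
    factor : ∀ {y} (a : Fin (suc y)) {P k} → P ≈ powR R x k →
             α R x a * P ≈ powR R x (if not (a ==ᶠ F.zero) then suc k else k)
    factor F.zero    e = ≈-trans (*-identityˡ _) e
    factor (F.suc a) e = *-cong ≈-refl e

  ∏-one : ∀ {A : Set} (f : A → Carrier) (xs : List A) → (∀ a → f a ≈ 1#) → ∏ f xs ≈ 1#
  ∏-one f []       h = ≈-refl
  ∏-one f (a ∷ xs) h = ≈-trans (*-cong (h a) (∏-one f xs h)) (*-identityˡ 1#)

  weight : ∀ {n y} (G : SimpleGraph n) (h : Fin n → Fin (suc y)) →
           ∏ (λ v → α R x (h v)) (allFin n)
             * ∏ (λ u → ∏ (λ v → if adj G u v ∧ (toℕ u <ᵇ toℕ v) then β R (h u) (h v) else 1#) (allFin n)) (allFin n)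
           ≈ powR R x (card (support h))
  weight {n} G h =
    ≈-trans (*-cong (∏-α h (allFin n)) (∏-one _ (allFin n) (λ u → ∏-one _ (allFin n) (λ v → β-one (adj G u v ∧ (toℕ u <ᵇ toℕ v))))))
            (*-identityʳ _)
    where
    β-one : ∀ b → (if b then 1# else 1#) ≈ 1#
    β-one true  = ≈-refl
    β-one false = ≈-refl

theorem4p3 : {c ℓ : Level} (R : CommutativeSemiring c ℓ) (x : CommutativeSemiring.Carrier R)
             (y n : ℕ) (G : SimpleGraph n) →
             CommutativeSemiring._≈_ R (Q R G x y) (homSum R G x y)
theorem4p3 R x y n G = begin
    ∑ (λ X → powR R x (card X) * fromℕ R (y ^ components G X)) Subsets
  ≈⟨ ∑-cong Subsets (λ X → *-cong ≈-refl (reflexive (cong (fromℕ R) (sym (ComponentSystem.hom-count G X y))))) ⟩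
    ∑ (λ X → powR R x (card X) * fromℕ R (countB (homWithSupport X) Maps)) Subsets
  ≈⟨ ∑-cong Subsets (λ X → ∑-count (powR R x (card X)) (homWithSupport X) Maps) ⟩
    ∑ (λ X → ∑ (λ h → if homWithSupport X h then powR R x (card X) else 0#) Maps) Subsets
  ≈⟨ ∑-swap (λ X h → if homWithSupport X h then powR R x (card X) else 0#) Subsets Maps ⟩
    ∑ (λ h → ∑ (λ X → if homWithSupport X h then powR R x (card X) else 0#) Subsets) Maps
  ≈⟨ ∑-cong Maps (λ h → ≈-trans (∑-guard (isHom G h) (sameSubset (support h)) (powR R x ∘ card) Subsets)
                                (if-cong (isHom G h) (∑-subset-indicator n (support h) (powR R x ∘ card) card-ext))) ⟩
    ∑ (λ h → if isHom G h then powR R x (card (support h)) else 0#) Maps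
  ≈⟨ ∑-cong Maps (λ h → if-cong (isHom G h) (≈-sym (weight G h))) ⟩
    homSum R G x y ∎
  where
  open CommutativeSemiring R renaming (refl to ≈-refl; sym to ≈-sym; trans to ≈-trans) hiding (zero)
  open import Relation.Binary.Reasoning.Setoid setoid
  open Sums R
  open Weights R x

  Subsets : List (Fin n → Bool)
  Subsets = allSubsets n

  Maps : List (Fin n → Fin (suc y))
  Maps = allFuns (allFin (suc y)) n

  homWithSupport : (Fin n → Bool) → (Fin n → Fin (suc y)) → Bool
  homWithSupport X h = isHom G h ∧ sameSubset (support h) X

  card-ext : Extensional (powR R x ∘ card)
  card-ext X X′ e = reflexive (cong (powR R x) (countB-cong (allFin n) e))
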